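{- Let $E$ be a finite set, $\mathcal{L}$ a set of subsets of $E$, and suppose $T(\mathcal{L})$ acts transitively and imprimitively on $\mathcal{L}$, with a system of blocks of imprimitivity. If the block size is odd, then there exist disjoint sets $E_1,E_2$ and $\mathcal{L}_i\subseteq 2^{E_i}$ with $|\mathcal{L}_1|\ge 2$ and $|\mathcal{L}_2|\ge 2$ such that $\mathcal{L}=\mathcal{L}_1\otimes\mathcal{L}_2$.
   Context: For $e\in E$, the toggle $\tau_e:\mathcal{L}\to\mathcal{L}$ is defined by $\tau_e(X)=X\triangle\{e\}$ if $X\triangle\{e\}\in\mathcal{L}$, and $\tau_e(X)=X$ otherwise. The toggle group $T(\mathcal{L})$ is the subgroup of the symmetric group on $\mathcal{L}$ generated by $\{\tau_e: e\in E\}$. Convention: every $e\in E$ for which $\tau_e$ is the identity permutation is removed from $E$. A block for $T(\mathcal{L})$ is a subset $\mathcal{B}\subseteq\mathcal{L}$ such that for every $g\in T(\mathcal{L})$ either $g(\mathcal{B})=\mathcal{B}$ or $g(\mathcal{B})\cap\mathcal{B}=\emptyset$; a system of blocks is the partition $\{g(\mathcal{B}):g\in T(\mathcal{L})\}$. A system of blocks of imprimitivity is one whose common block size is strictly between $1$ and $|\mathcal{L}|$; the action is imprimitive if such a system exists. For disjoint finite sets $E_1,E_2$ and $\mathcal{L}_i\subseteq 2^{E_i}$, the toggle-disjoint Cartesian product is $\mathcal{L}_1\otimes\mathcal{L}_2=\{X_1\cup X_2: X_1\in\mathcal{L}_1, X_2\in\mathcal{L}_2\}$. -}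

module Defs where

open import Data.Nat using (ℕ; zero; suc; _+_)
open import Data.Bool using (Bool; true; false; not; if_then_else_)
open import Data.Vec using (Vec; []; _∷_; map; updateAt)
open import Data.List using (List; []; _∷_; _++_; length; filter; foldr)
open import Data.Fin using (Fin)
open import Data.Fin.Subset using (Subset; _⊆_; _∪_; _∈_; _∉_)
open import Data.Product using (Σ; ∃; _×_; _,_)
open import Relation.Binary.PropositionalEquality using (_≡_)
open import Relation.Nullary using (¬_)
open import Data.Bool.Properties using (_≟_)

-- A family of subsets of E = Fin n, represented by its (decidable) indicator.
Family : ℕ → Set
Family n = Subset n → Bool

_∈𝓛_ : ∀ {n} → Subset n → Family n → Set
X ∈𝓛 𝓛 = 𝓛 X ≡ true

allSubsets : (n : ℕ) → List (Subset n)
allSubsets zero = [] ∷ []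
allSubsets (suc n) = Data.List.map (true ∷_) (allSubsets n) ++ Data.List.map (false ∷_) (allSubsets n)

card : ∀ {n} → Family n → ℕ
card {n} 𝓛 = length (filter (λ X → 𝓛 X ≟ true) (allSubsets n))

symDiffSingleton : ∀ {n} → Subset n → Fin n → Subset n
symDiffSingleton X e = updateAt X e not

toggle : ∀ {n} → Family n → Fin n → Subset n → Subset n
toggle 𝓛 e X = if 𝓛 (symDiffSingleton X e) then symDiffSingleton X e else X

NontrivialToggle : ∀ {n} → Family n → Fin n → Set
NontrivialToggle 𝓛 e = ∃ λ X → X ∈𝓛 𝓛 × ¬ (toggle 𝓛 e X ≡ X)

-- Elements of T(𝓛): since each τ_e is an involution, every element of the
-- generated group is a finite composition of toggles, i.e. given by a word.
-- act (e₁ ∷ … ∷ e_k) = τ_{e₁} ∘ … ∘ τ_{e_k}.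
act : ∀ {n} → Family n → List (Fin n) → Subset n → Subset n
act 𝓛 w X = foldr (λ e Y → toggle 𝓛 e Y) X w

Transitive : ∀ {n} → Family n → Set
Transitive {n} 𝓛 = ∀ X Y → X ∈𝓛 𝓛 → Y ∈𝓛 𝓛 → ∃ λ (w : List (Fin n)) → act 𝓛 w X ≡ Y

IsBlock : ∀ {n} → Family n → Family n → Set
IsBlock {n} 𝓛 𝓑 =
  (∀ X → X ∈𝓛 𝓑 → X ∈𝓛 𝓛) ×
  (∀ (w : List (Fin n)) →
     (∀ Y → ((∃ λ X → X ∈𝓛 𝓑 × act 𝓛 w X ≡ Y) → Y ∈𝓛 𝓑)
           × (Y ∈𝓛 𝓑 → ∃ λ X → X ∈𝓛 𝓑 × act 𝓛 w X ≡ Y))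
     Data.Sum.⊎
     (∀ X → X ∈𝓛 𝓑 → ¬ (act 𝓛 w X ∈𝓛 𝓑)))
  where import Data.Sum

IsImprimitivityBlock : ∀ {n} → Family n → Family n → Set
IsImprimitivityBlock 𝓛 𝓑 = IsBlock 𝓛 𝓑 × 1 Data.Nat.< card 𝓑 × card 𝓑 Data.Nat.< card 𝓛
  where import Data.Nat

Odd : ℕ → Set
Odd m = ∃ λ k → m ≡ suc (k + k)

Disjoint : ∀ {n} → Subset n → Subset n → Set
Disjoint E₁ E₂ = ∀ e → e ∈ E₁ → e ∉ E₂

FamilyOver : ∀ {n} → Family n → Subset n → Set
FamilyOver 𝓛 E = ∀ X → X ∈𝓛 𝓛 → X ⊆ E

IsProduct : ∀ {n} → Family n → Family n → Family n → Set
IsProduct 𝓛 𝓛₁ 𝓛₂ = ∀ X → (X ∈𝓛 𝓛 → ∃ λ X₁ → ∃ λ X₂ → X₁ ∈𝓛 𝓛₁ × X₂ ∈𝓛 𝓛₂ × X ≡ X₁ ∪ X₂)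
                          × ((∃ λ X₁ → ∃ λ X₂ → X₁ ∈𝓛 𝓛₁ × X₂ ∈𝓛 𝓛₂ × X ≡ X₁ ∪ X₂) → X ∈𝓛 𝓛)

module Submission where

-- Call a coordinate e internal if some X, X △ e ∈ 𝓛 lie in one block.  Having such an e-edge is
-- a property of a block that the toggles preserve, so by transitivity τ_e then preserves every
-- block, while for external e whether τ_e moves a set is constant on blocks.  Hence a word changes
-- an external coordinate on all of a block or on none of it.  A word carrying one member of 𝓑 to
-- another maps 𝓑 onto itself, so if it changed coordinate e it would pair off the members of 𝓑 by
-- their e-th coordinate; as |𝓑| is odd, external coordinates are constant on blocks.  Carrying Y to
-- X with only the external toggles of such a word yields the set agreeing with X externally and
-- with Y internally, so 𝓛 is closed under this splicing, hence the product of its external and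
-- internal parts.  The internal factor is nontrivial since 𝓑 has two members, the external one
-- since otherwise 𝓛 would be a single block.

open import Defs
open import Data.Bool using (Bool; true; false; not; _∧_; _∨_; _xor_; if_then_else_)
import Data.Bool.Properties as Boolₚ
open import Data.Fin using (Fin)
import Data.Fin.Properties as Finₚ
open import Data.Fin.Subset using (Subset; _∪_; _∩_; ∁; _⊆_) renaming (_∈_ to _∈ˢ_; ⊥ to ∅)
open import Data.Fin.Subset.Properties using (_⊆?_; x∈∁p⇒x∉p)
open import Data.List as List using (List; []; _∷_; _++_; length; filter)
import Data.List.Properties as Listₚ
open import Data.List.Membership.Propositional using (_∈_)
import Data.List.Membership.Propositional.Properties as Memₚ
open import Data.List.Relation.Unary.All using ([]; _∷_)
open import Data.List.Relation.Unary.AllPairs using ([]; _∷_)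
open import Data.List.Relation.Unary.Any using (here; there)
open import Data.List.Relation.Unary.Unique.Propositional using (Unique)
import Data.List.Relation.Unary.Unique.Propositional.Properties as Uniqueₚ
open import Data.Nat using (ℕ; zero; suc; _+_; _*_; _≤_; _<_; z≤n; s≤s)
import Data.Nat.Properties as ℕₚ
open import Data.Product using (∃; ∃₂; _×_; _,_; proj₁; proj₂)
open import Data.Sum using (_⊎_; inj₁; inj₂)
open import Data.Vec as Vec using (lookup; updateAt; tabulate)
import Data.Vec.Properties as Vecₚ
open import Function using (_∘_; id)
open import Relation.Binary.PropositionalEquality
open import Relation.Nullary using (¬_; Dec; yes; no; does; contradiction)

∧-≡-true⁻ : ∀ {a b} → a ∧ b ≡ true → a ≡ true × b ≡ true
∧-≡-true⁻ {true} b≡true = refl , b≡true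

∧-≡-true⁺ : ∀ {a b} → a ≡ true → b ≡ true → a ∧ b ≡ true
∧-≡-true⁺ refl refl = refl

xor≡true⇒≡not : ∀ {x y} → x xor y ≡ true → y ≡ not x
xor≡true⇒≡not {false} y≡true = y≡true
xor≡true⇒≡not {true} {y} ¬y≡true = trans (sym (Boolₚ.not-involutive y)) (cong not ¬y≡true)

-- Counting members of a family

module _ {A B : Set} where

  private
    remove : ∀ {y : B} ys → y ∈ ys → List B
    remove (_ ∷ ys) (here _)  = ys
    remove (y ∷ ys) (there p) = y ∷ remove ys p

    length-remove : ∀ {y : B} ys (p : y ∈ ys) → length ys ≡ suc (length (remove ys p))
    length-remove (_ ∷ ys) (here _)  = refl
    length-remove (_ ∷ ys) (there p) = cong suc (length-remove ys p)

    ∈-remove : ∀ {y z : B} ys (p : y ∈ ys) → z ∈ ys → z ≢ y → z ∈ remove ys p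
    ∈-remove (_ ∷ _)  (here refl) (here refl) z≢y = contradiction refl z≢y
    ∈-remove (_ ∷ _)  (here refl) (there q)   _   = q
    ∈-remove (_ ∷ _)  (there p)   (here refl) _   = here refl
    ∈-remove (_ ∷ ys) (there p)   (there q)   z≢y = there (∈-remove ys p q z≢y)

  length-≤-injection : (f : A → B) {xs : List A} {ys : List B} → Unique xs →
                       (∀ {x y} → x ∈ xs → y ∈ xs → f x ≡ f y → x ≡ y) →
                       (∀ {x} → x ∈ xs → f x ∈ ys) → length xs ≤ length ys
  length-≤-injection f {[]}     _               _   _    = z≤n
  length-≤-injection f {x ∷ xs} {ys} u@(_ ∷ u′) inj into =
    subst (suc (length xs) ≤_) (sym (length-remove ys fx∈ys))
      (s≤s (length-≤-injection f u′ (λ p q → inj (there p) (there q)) into′))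
    where
    fx∈ys : f x ∈ ys
    fx∈ys = into (here refl)
    into′ : ∀ {z} → z ∈ xs → f z ∈ remove ys fx∈ys
    into′ z∈xs = ∈-remove ys fx∈ys (into (there z∈xs))
      (λ fz≡fx → Uniqueₚ.Unique[x∷xs]⇒x∉xs u (subst (_∈ xs) (inj (there z∈xs) (here refl) fz≡fx) z∈xs))

allSubsets-complete : ∀ n (X : Subset n) → X ∈ allSubsets n
allSubsets-complete zero    Vec.[]          = here refl
allSubsets-complete (suc n) (true  Vec.∷ X) =
  Memₚ.∈-++⁺ˡ (Memₚ.∈-map⁺ (true Vec.∷_) (allSubsets-complete n X))
allSubsets-complete (suc n) (false Vec.∷ X) =
  Memₚ.∈-++⁺ʳ _ (Memₚ.∈-map⁺ (false Vec.∷_) (allSubsets-complete n X))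

allSubsets-unique : ∀ n → Unique (allSubsets n)
allSubsets-unique zero    = [] ∷ []
allSubsets-unique (suc n) = Uniqueₚ.++⁺ (Uniqueₚ.map⁺ Vecₚ.∷-injectiveʳ (allSubsets-unique n))
                                        (Uniqueₚ.map⁺ Vecₚ.∷-injectiveʳ (allSubsets-unique n))
                                        heads-differ
  where
  heads-differ : ∀ {X} → ¬ (X ∈ List.map (true Vec.∷_) (allSubsets n) × X ∈ List.map (false Vec.∷_) (allSubsets n))
  heads-differ (p , q) with Memₚ.∈-map⁻ (true Vec.∷_) p | Memₚ.∈-map⁻ (false Vec.∷_) q
  ... | _ , _ , refl | _ , _ , ()

module _ {n : ℕ} where

  members : Family n → List (Subset n)
  members 𝓐 = filter (λ X → 𝓐 X Boolₚ.≟ true) (allSubsets n)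

  ∈-members⁺ : ∀ {𝓐 X} → X ∈𝓛 𝓐 → X ∈ members 𝓐
  ∈-members⁺ {𝓐} {X} = Memₚ.∈-filter⁺ (λ X → 𝓐 X Boolₚ.≟ true) (allSubsets-complete n X)

  ∈-members⁻ : ∀ {𝓐 X} → X ∈ members 𝓐 → X ∈𝓛 𝓐
  ∈-members⁻ {𝓐} = proj₂ ∘ Memₚ.∈-filter⁻ (λ X → 𝓐 X Boolₚ.≟ true) {xs = allSubsets n}

  members-unique : ∀ 𝓐 → Unique (members 𝓐)
  members-unique 𝓐 = Uniqueₚ.filter⁺ (λ X → 𝓐 X Boolₚ.≟ true) (allSubsets-unique n)

  InjectiveOn : Family n → (Subset n → Subset n) → Set
  InjectiveOn 𝓐 h = ∀ {X Y} → X ∈𝓛 𝓐 → Y ∈𝓛 𝓐 → h X ≡ h Y → X ≡ Y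

  injectiveOn-∧ : ∀ {𝓐 h} (q : Subset n → Bool) → InjectiveOn 𝓐 h → InjectiveOn (λ X → 𝓐 X ∧ q X) h
  injectiveOn-∧ _ inj X∈ Y∈ = inj (proj₁ (∧-≡-true⁻ X∈)) (proj₁ (∧-≡-true⁻ Y∈))

  card-≤-injection : ∀ {𝓐 𝓒} (h : Subset n → Subset n) → (∀ {X} → X ∈𝓛 𝓐 → h X ∈𝓛 𝓒) →
                     InjectiveOn 𝓐 h → card 𝓐 ≤ card 𝓒
  card-≤-injection {𝓐} h into inj =
    length-≤-injection h (members-unique 𝓐)
      (λ p q → inj (∈-members⁻ p) (∈-members⁻ q)) (∈-members⁺ ∘ into ∘ ∈-members⁻)

  ⊆⇒card-≤ : ∀ {𝓐 𝓒 : Family n} → (∀ {X} → X ∈𝓛 𝓐 → X ∈𝓛 𝓒) → card 𝓐 ≤ card 𝓒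
  ⊆⇒card-≤ {𝓐} {𝓒} into = card-≤-injection {𝓐} {𝓒} id into (λ _ _ → id)

  distinct⇒2≤card : ∀ {𝓐 X Y} → X ∈𝓛 𝓐 → Y ∈𝓛 𝓐 → X ≢ Y → 2 ≤ card 𝓐
  distinct⇒2≤card {𝓐} {X} {Y} X∈ Y∈ X≢Y = length-≤-injection id ((X≢Y ∷ []) ∷ [] ∷ []) (λ _ _ → id) into
    where
    into : ∀ {Z} → Z ∈ X ∷ Y ∷ [] → Z ∈ members 𝓐
    into (here refl)         = ∈-members⁺ X∈
    into (there (here refl)) = ∈-members⁺ Y∈

  2≤card⇒distinct : ∀ {𝓐} → 2 ≤ card 𝓐 → ∃₂ λ X Y → X ∈𝓛 𝓐 × Y ∈𝓛 𝓐 × X ≢ Y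
  2≤card⇒distinct {𝓐} 2≤ = go (members 𝓐) 2≤ (members-unique 𝓐) ∈-members⁻
    where
    go : (xs : List (Subset n)) → 2 ≤ length xs → Unique xs → (∀ {X} → X ∈ xs → X ∈𝓛 𝓐) →
         ∃₂ λ X Y → X ∈𝓛 𝓐 × Y ∈𝓛 𝓐 × X ≢ Y
    go (X ∷ Y ∷ _) _        ((X≢Y ∷ _) ∷ _) ∈𝓐 = X , Y , ∈𝓐 (here refl) , ∈𝓐 (there (here refl)) , X≢Y
    go (_ ∷ [])    (s≤s ()) _                _

  card-split : ∀ (𝓐 : Family n) (p : Subset n → Bool) →
               card 𝓐 ≡ card (λ X → 𝓐 X ∧ p X) + card (λ X → 𝓐 X ∧ not (p X))
  card-split 𝓐 p = go (allSubsets n)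
    where
    count : Family n → List (Subset n) → ℕ
    count 𝓒 xs = length (filter (λ X → 𝓒 X Boolₚ.≟ true) xs)
    go : ∀ xs → count 𝓐 xs ≡ count (λ X → 𝓐 X ∧ p X) xs + count (λ X → 𝓐 X ∧ not (p X)) xs
    go []       = refl
    go (X ∷ xs) with 𝓐 X | p X
    ... | false | _     = go xs
    ... | true  | true  = cong suc (go xs)
    ... | true  | false = trans (cong suc (go xs)) (sym (ℕₚ.+-suc _ _))

  flipping-injection⇒¬odd-card : ∀ (𝓐 : Family n) (p : Subset n → Bool) (h : Subset n → Subset n) →
    (∀ {X} → X ∈𝓛 𝓐 → h X ∈𝓛 𝓐) → (∀ {X} → X ∈𝓛 𝓐 → p (h X) ≡ not (p X)) →
    InjectiveOn 𝓐 h → ¬ Odd (card 𝓐)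
  flipping-injection⇒¬odd-card 𝓐 p h into flips inj (k , card≡) =
    ℕₚ.even≢odd (card 𝓐⁺) k (begin
      2 * card 𝓐⁺             ≡⟨ cong (card 𝓐⁺ +_) (ℕₚ.+-identityʳ _) ⟩
      card 𝓐⁺ + card 𝓐⁺       ≡⟨ cong (card 𝓐⁺ +_) (ℕₚ.≤-antisym ⁺≤⁻ ⁻≤⁺) ⟩
      card 𝓐⁺ + card 𝓐⁻       ≡⟨ sym (card-split 𝓐 p) ⟩
      card 𝓐                  ≡⟨ card≡ ⟩
      suc (k + k)             ≡⟨ cong (λ m → suc (k + m)) (sym (ℕₚ.+-identityʳ k)) ⟩
      suc (2 * k)             ∎)
    where
    open ≡-Reasoning
    𝓐⁺ 𝓐⁻ : Family n
    𝓐⁺ X = 𝓐 X ∧ p X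
    𝓐⁻ X = 𝓐 X ∧ not (p X)
    ⁺≤⁻ : card 𝓐⁺ ≤ card 𝓐⁻
    ⁺≤⁻ = card-≤-injection {𝓐⁺} {𝓐⁻} h into⁻ (injectiveOn-∧ p inj)
      where
      into⁻ : ∀ {X} → X ∈𝓛 𝓐⁺ → h X ∈𝓛 𝓐⁻
      into⁻ X∈ with X∈𝓐 , pX ← ∧-≡-true⁻ X∈ =
        ∧-≡-true⁺ (into X∈𝓐) (trans (cong not (flips X∈𝓐)) (trans (Boolₚ.not-involutive _) pX))
    ⁻≤⁺ : card 𝓐⁻ ≤ card 𝓐⁺
    ⁻≤⁺ = card-≤-injection {𝓐⁻} {𝓐⁺} h into⁺ (injectiveOn-∧ (not ∘ p) inj)
      where
      into⁺ : ∀ {X} → X ∈𝓛 𝓐⁻ → h X ∈𝓛 𝓐⁺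
      into⁺ X∈ with X∈𝓐 , ¬pX ← ∧-≡-true⁻ X∈ = ∧-≡-true⁺ (into X∈𝓐) (trans (flips X∈𝓐) ¬pX)

-- Subsets as Boolean vectors

module _ {n : ℕ} where

  ≗⇒≡ : ∀ {X Y : Subset n} → (∀ i → lookup X i ≡ lookup Y i) → X ≡ Y
  ≗⇒≡ {X} {Y} X≗Y = begin
    X                   ≡⟨ Vecₚ.tabulate∘lookup X ⟨
    tabulate (lookup X) ≡⟨ Vecₚ.tabulate-cong X≗Y ⟩
    tabulate (lookup Y) ≡⟨ Vecₚ.tabulate∘lookup Y ⟩
    Y                   ∎
    where open ≡-Reasoning

  lookup-∪ : ∀ (X Y : Subset n) i → lookup (X ∪ Y) i ≡ lookup X i ∨ lookup Y i
  lookup-∪ X Y i = Vecₚ.lookup-zipWith _∨_ i X Y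

  lookup-∩ : ∀ (X Y : Subset n) i → lookup (X ∩ Y) i ≡ lookup X i ∧ lookup Y i
  lookup-∩ X Y i = Vecₚ.lookup-zipWith _∧_ i X Y

  lookup-∁ : ∀ (X : Subset n) i → lookup (∁ X) i ≡ not (lookup X i)
  lookup-∁ X i = Vecₚ.lookup-map i not X

  ∈⇒lookup : ∀ {X : Subset n} {i} → i ∈ˢ X → lookup X i ≡ true
  ∈⇒lookup = Vecₚ.[]=⇒lookup

  lookup⇒∈ : ∀ {X : Subset n} {i} → lookup X i ≡ true → i ∈ˢ X
  lookup⇒∈ = Vecₚ.lookup⇒[]= _ _

  differAt : Fin n → Subset n → Subset n → Bool
  differAt i X Y = lookup X i xor lookup Y i

  differAt-trans : ∀ i X Y Z → differAt i X Z ≡ differAt i X Y xor differAt i Y Z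
  differAt-trans i X Y Z = cancel (lookup X i) (lookup Y i) (lookup Z i)
    where
    cancel : ∀ x y z → x xor z ≡ (x xor y) xor (y xor z)
    cancel false false z = refl
    cancel false true  z = sym (Boolₚ.not-involutive z)
    cancel true  false z = refl
    cancel true  true  z = refl

  infixl 25 _△_
  _△_ : Subset n → Fin n → Subset n
  _△_ = symDiffSingleton

  lookup-△-≡ : ∀ (X : Subset n) i → lookup (X △ i) i ≡ not (lookup X i)
  lookup-△-≡ X i = Vecₚ.lookup∘updateAt i X

  lookup-△-≢ : ∀ (X : Subset n) {e i} → e ≢ i → lookup (X △ e) i ≡ lookup X i
  lookup-△-≢ X e≢i = Vecₚ.lookup∘updateAt′ _ _ (e≢i ∘ sym) X

  △-involutive : ∀ (X : Subset n) e → X △ e △ e ≡ X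
  △-involutive X e = begin
    X △ e △ e                 ≡⟨ Vecₚ.updateAt-updateAt e X ⟩
    updateAt X e (not ∘ not)  ≡⟨ Vecₚ.updateAt-cong e Boolₚ.not-involutive X ⟩
    updateAt X e id           ≡⟨ Vecₚ.updateAt-id e X ⟩
    X                         ∎
    where open ≡-Reasoning

  △-comm : ∀ (X : Subset n) e f → X △ e △ f ≡ X △ f △ e
  △-comm X e f with e Finₚ.≟ f
  ... | yes refl = refl
  ... | no e≢f   = Vecₚ.updateAt-commutes f e (e≢f ∘ sym) X

  splice : Subset n → Subset n → Subset n → Subset n
  splice E X Y = (X ∩ ∁ E) ∪ (Y ∩ E)

  lookup-splice : ∀ E X Y i → lookup (splice E X Y) i ≡ (if lookup E i then lookup Y i else lookup X i)
  lookup-splice E X Y i = begin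
    lookup (splice E X Y) i
      ≡⟨ lookup-∪ (X ∩ ∁ E) (Y ∩ E) i ⟩
    lookup (X ∩ ∁ E) i ∨ lookup (Y ∩ E) i
      ≡⟨ cong₂ _∨_ (lookup-∩ X (∁ E) i) (lookup-∩ Y E i) ⟩
    lookup X i ∧ lookup (∁ E) i ∨ lookup Y i ∧ lookup E i
      ≡⟨ cong (λ b → lookup X i ∧ b ∨ lookup Y i ∧ lookup E i) (lookup-∁ E i) ⟩
    lookup X i ∧ not (lookup E i) ∨ lookup Y i ∧ lookup E i
      ≡⟨ select (lookup E i) (lookup X i) (lookup Y i) ⟩
    (if lookup E i then lookup Y i else lookup X i)
      ∎
    where
    open ≡-Reasoning
    select : ∀ c x y → x ∧ not c ∨ y ∧ c ≡ (if c then y else x)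
    select false x y = trans (cong₂ _∨_ (Boolₚ.∧-identityʳ x) (Boolₚ.∧-zeroʳ y)) (Boolₚ.∨-identityʳ x)
    select true  x y = trans (cong (_∨ y ∧ true) (Boolₚ.∧-zeroʳ x)) (Boolₚ.∧-identityʳ y)

  splice-unique : ∀ {E X Y Z} → (∀ i → lookup Z i ≡ (if lookup E i then lookup Y i else lookup X i)) →
                  splice E X Y ≡ Z
  splice-unique {E} {X} {Y} Z≗ = ≗⇒≡ λ i → trans (lookup-splice E X Y i) (sym (Z≗ i))

  splice-self : ∀ E X → splice E X X ≡ X
  splice-self E X = splice-unique λ i → sym (Boolₚ.if-eta (lookup E i))

  splice-splice : ∀ E A B C D → splice E (splice E A B) (splice E C D) ≡ splice E A D
  splice-splice E A B C D = splice-unique λ i → begin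
    lookup (splice E A D) i
      ≡⟨ lookup-splice E A D i ⟩
    (if lookup E i then lookup D i else lookup A i)
      ≡⟨ nested (lookup E i) ⟨
    (if lookup E i then (if lookup E i then lookup D i else lookup C i)
                   else (if lookup E i then lookup B i else lookup A i))
      ≡⟨ cong₂ (if lookup E i then_else_) (lookup-splice E C D i) (lookup-splice E A B i) ⟨
    (if lookup E i then lookup (splice E C D) i else lookup (splice E A B) i)
      ∎
    where
    open ≡-Reasoning
    nested : ∀ c {a b c′ d : Bool} →
             (if c then (if c then d else c′) else (if c then b else a)) ≡ (if c then d else a)
    nested false = refl
    nested true  = refl

  ⊆⇒lookup-false : ∀ {X Y : Subset n} {i} → X ⊆ Y → lookup Y i ≡ false → lookup X i ≡ false
  ⊆⇒lookup-false {X} {i = i} X⊆Y Yi≡false with lookup X i in Xi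
  ... | false = refl
  ... | true  = contradiction (trans (sym (∈⇒lookup (X⊆Y (lookup⇒∈ Xi)))) Yi≡false) λ ()

  ⊆∁⇒lookup-false : ∀ {X E : Subset n} {i} → X ⊆ ∁ E → lookup E i ≡ true → lookup X i ≡ false
  ⊆∁⇒lookup-false {E = E} {i} X⊆∁E Ei≡true = ⊆⇒lookup-false X⊆∁E (trans (lookup-∁ E i) (cong not Ei≡true))

  splice-∪ : ∀ {E X Y} → X ⊆ ∁ E → Y ⊆ E → splice E X Y ≡ X ∪ Y
  splice-∪ {E} {X} {Y} X⊆∁E Y⊆E = splice-unique λ i → trans (lookup-∪ X Y i) (select i)
    where
    select : ∀ i → lookup X i ∨ lookup Y i ≡ (if lookup E i then lookup Y i else lookup X i)
    select i with lookup E i in Ei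
    ... | true  = cong (_∨ lookup Y i) (⊆∁⇒lookup-false X⊆∁E Ei)
    ... | false = trans (cong (lookup X i ∨_) (⊆⇒lookup-false Y⊆E Ei)) (Boolₚ.∨-identityʳ _)

  lookup-∅ : ∀ i → lookup (∅ {n}) i ≡ false
  lookup-∅ i = Vecₚ.lookup-replicate i false

  splice-∅ʳ-⊆ : ∀ E X → splice E X ∅ ⊆ ∁ E
  splice-∅ʳ-⊆ E X {i} i∈ with lookup E i in Ei | trans (sym (lookup-splice E X ∅ i)) (∈⇒lookup i∈)
  ... | true  | ∅i≡true = contradiction (trans (sym (lookup-∅ i)) ∅i≡true) λ ()
  ... | false | _       = lookup⇒∈ (trans (lookup-∁ E i) (cong not Ei))

  splice-∅ˡ-⊆ : ∀ E Y → splice E ∅ Y ⊆ E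
  splice-∅ˡ-⊆ E Y {i} i∈ with lookup E i in Ei | trans (sym (lookup-splice E ∅ Y i)) (∈⇒lookup i∈)
  ... | true  | _       = lookup⇒∈ Ei
  ... | false | ∅i≡true = contradiction (trans (sym (lookup-∅ i)) ∅i≡true) λ ()

  restrict : Family n → Subset n → Family n
  restrict 𝓐 E Y = 𝓐 Y ∧ does (Y ⊆? E)

  restrict⁺ : ∀ {𝓐 E Y} → Y ∈𝓛 𝓐 → Y ⊆ E → Y ∈𝓛 restrict 𝓐 E
  restrict⁺ {E = E} {Y} Y∈𝓐 Y⊆E with Y ⊆? E
  ... | yes _   = trans (Boolₚ.∧-identityʳ _) Y∈𝓐
  ... | no Y⊈E = contradiction (λ {i} → Y⊆E {i}) Y⊈E

  restrict⁻ : ∀ {𝓐 E Y} → Y ∈𝓛 restrict 𝓐 E → Y ∈𝓛 𝓐 × Y ⊆ E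
  restrict⁻ {E = E} {Y} Y∈ with Y ⊆? E
  ... | yes Y⊆E = trans (sym (Boolₚ.∧-identityʳ _)) Y∈ , Y⊆E
  ... | no _    = contradiction (trans (sym (Boolₚ.∧-zeroʳ _)) Y∈) λ ()

-- Families closed under splicing are products

module SpliceClosed {n : ℕ} (𝓛 : Family n) (E : Subset n)
                    (splice-closed : ∀ {X Y} → X ∈𝓛 𝓛 → Y ∈𝓛 𝓛 → splice E X Y ∈𝓛 𝓛)
                    (B : Subset n) (B∈𝓛 : B ∈𝓛 𝓛) where

  completeInside completeOutside : Family n
  completeInside  Y = 𝓛 (splice E Y B)
  completeOutside Y = 𝓛 (splice E B Y)

  outerFactor innerFactor : Family n
  outerFactor = restrict completeInside (∁ E)
  innerFactor = restrict completeOutside E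

  outer∈outerFactor : ∀ {X} → X ∈𝓛 𝓛 → splice E X ∅ ∈𝓛 outerFactor
  outer∈outerFactor {X} X∈𝓛 =
    restrict⁺ {𝓐 = completeInside} (subst (_∈𝓛 𝓛) splices (splice-closed X∈𝓛 B∈𝓛)) (splice-∅ʳ-⊆ E X)
    where
    splices : splice E X B ≡ splice E (splice E X ∅) B
    splices = trans (sym (splice-splice E X ∅ B B)) (cong (splice E (splice E X ∅)) (splice-self E B))

  inner∈innerFactor : ∀ {X} → X ∈𝓛 𝓛 → splice E ∅ X ∈𝓛 innerFactor
  inner∈innerFactor {X} X∈𝓛 =
    restrict⁺ {𝓐 = completeOutside} (subst (_∈𝓛 𝓛) splices (splice-closed B∈𝓛 X∈𝓛)) (splice-∅ˡ-⊆ E X)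
    where
    splices : splice E B X ≡ splice E B (splice E ∅ X)
    splices = trans (sym (splice-splice E B B ∅ X)) (cong (λ Z → splice E Z (splice E ∅ X)) (splice-self E B))

  isProduct : IsProduct 𝓛 outerFactor innerFactor
  isProduct X = factorise , combine
    where
    factorise : X ∈𝓛 𝓛 → ∃₂ λ X₁ X₂ → X₁ ∈𝓛 outerFactor × X₂ ∈𝓛 innerFactor × X ≡ X₁ ∪ X₂
    factorise X∈𝓛 = splice E X ∅ , splice E ∅ X , outer∈outerFactor X∈𝓛 , inner∈innerFactor X∈𝓛 , (begin
      X                                         ≡⟨ splice-self E X ⟨
      splice E X X                              ≡⟨ splice-splice E X ∅ ∅ X ⟨
      splice E (splice E X ∅) (splice E ∅ X)    ≡⟨ splice-∪ (splice-∅ʳ-⊆ E X) (splice-∅ˡ-⊆ E X) ⟩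
      splice E X ∅ ∪ splice E ∅ X               ∎)
      where open ≡-Reasoning
    combine : (∃₂ λ X₁ X₂ → X₁ ∈𝓛 outerFactor × X₂ ∈𝓛 innerFactor × X ≡ X₁ ∪ X₂) → X ∈𝓛 𝓛
    combine (X₁ , X₂ , X₁∈ , X₂∈ , refl)
      with X₁B∈𝓛 , X₁⊆∁E ← restrict⁻ {𝓐 = completeInside} X₁∈
         | BX₂∈𝓛 , X₂⊆E  ← restrict⁻ {𝓐 = completeOutside} X₂∈ =
      subst (_∈𝓛 𝓛) (trans (splice-splice E X₁ B B X₂) (splice-∪ X₁⊆∁E X₂⊆E)) (splice-closed X₁B∈𝓛 BX₂∈𝓛)

  outerFactor-over : FamilyOver outerFactor (∁ E)
  outerFactor-over _ X∈ = proj₂ (restrict⁻ {𝓐 = completeInside} X∈)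

  innerFactor-over : FamilyOver innerFactor E
  innerFactor-over _ X∈ = proj₂ (restrict⁻ {𝓐 = completeOutside} X∈)

  2≤card-outerFactor : ∀ {X Y} → X ∈𝓛 𝓛 → Y ∈𝓛 𝓛 → X ≢ Y →
                       (∀ i → lookup E i ≡ true → lookup X i ≡ lookup Y i) → 2 ≤ card outerFactor
  2≤card-outerFactor {X} {Y} X∈𝓛 Y∈𝓛 X≢Y agree-inside =
    distinct⇒2≤card (outer∈outerFactor X∈𝓛) (outer∈outerFactor Y∈𝓛) λ X₁≡Y₁ → X≢Y (≗⇒≡ λ i → agree X₁≡Y₁ i)
    where
    agree : splice E X ∅ ≡ splice E Y ∅ → ∀ i → lookup X i ≡ lookup Y i
    agree X₁≡Y₁ i with lookup E i in Ei
                     | trans (sym (lookup-splice E X ∅ i))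
                             (trans (cong (λ Z → lookup Z i) X₁≡Y₁) (lookup-splice E Y ∅ i))
    ... | true  | _       = agree-inside i Ei
    ... | false | Xi≡Yi = Xi≡Yi

  2≤card-innerFactor : ∀ {X Y} → X ∈𝓛 𝓛 → Y ∈𝓛 𝓛 → X ≢ Y →
                       (∀ i → lookup E i ≡ false → lookup X i ≡ lookup Y i) → 2 ≤ card innerFactor
  2≤card-innerFactor {X} {Y} X∈𝓛 Y∈𝓛 X≢Y agree-outside =
    distinct⇒2≤card (inner∈innerFactor X∈𝓛) (inner∈innerFactor Y∈𝓛) λ X₂≡Y₂ → X≢Y (≗⇒≡ λ i → agree X₂≡Y₂ i)
    where
    agree : splice E ∅ X ≡ splice E ∅ Y → ∀ i → lookup X i ≡ lookup Y i
    agree X₂≡Y₂ i with lookup E i in Ei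
                     | trans (sym (lookup-splice E ∅ X i))
                             (trans (cong (λ Z → lookup Z i) X₂≡Y₂) (lookup-splice E ∅ Y i))
    ... | true  | Xi≡Yi = Xi≡Yi
    ... | false | _       = agree-outside i Ei

-- The toggle group acting on a family

module ToggleAction {n : ℕ} (𝓛 : Family n) where

  toggle-cases : ∀ e X → (X △ e ∈𝓛 𝓛 × toggle 𝓛 e X ≡ X △ e) ⊎ (𝓛 (X △ e) ≡ false × toggle 𝓛 e X ≡ X)
  toggle-cases e X with 𝓛 (X △ e)
  ... | true  = inj₁ (refl , refl)
  ... | false = inj₂ (refl , refl)

  toggle-∈ : ∀ e {X} → X ∈𝓛 𝓛 → toggle 𝓛 e X ∈𝓛 𝓛
  toggle-∈ e {X} X∈𝓛 with toggle-cases e X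
  ... | inj₁ (X△e∈𝓛 , τX≡X△e) = subst (_∈𝓛 𝓛) (sym τX≡X△e) X△e∈𝓛
  ... | inj₂ (_ , τX≡X)        = subst (_∈𝓛 𝓛) (sym τX≡X) X∈𝓛

  toggle-△ : ∀ e {X} → X △ e ∈𝓛 𝓛 → toggle 𝓛 e X ≡ X △ e
  toggle-△ e {X} X△e∈𝓛 with toggle-cases e X
  ... | inj₁ (_ , τX≡X△e)        = τX≡X△e
  ... | inj₂ (X△e∉𝓛 , _)        = contradiction (trans (sym X△e∈𝓛) X△e∉𝓛) λ ()

  toggle-involutive : ∀ e {X} → X ∈𝓛 𝓛 → toggle 𝓛 e (toggle 𝓛 e X) ≡ X
  toggle-involutive e {X} X∈𝓛 with toggle-cases e X
  ... | inj₁ (_ , τX≡X△e) = begin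
    toggle 𝓛 e (toggle 𝓛 e X) ≡⟨ cong (toggle 𝓛 e) τX≡X△e ⟩
    toggle 𝓛 e (X △ e)         ≡⟨ toggle-△ e (subst (_∈𝓛 𝓛) (sym (△-involutive X e)) X∈𝓛) ⟩
    X △ e △ e                  ≡⟨ △-involutive X e ⟩
    X                          ∎
    where open ≡-Reasoning
  ... | inj₂ (_ , τX≡X) = trans (cong (toggle 𝓛 e) τX≡X) τX≡X

  lookup-toggle-≢ : ∀ {e i} X → e ≢ i → lookup (toggle 𝓛 e X) i ≡ lookup X i
  lookup-toggle-≢ {e} {i} X e≢i with toggle-cases e X
  ... | inj₁ (_ , τX≡X△e) = trans (cong (λ Z → lookup Z i) τX≡X△e) (lookup-△-≢ X e≢i)
  ... | inj₂ (_ , τX≡X)   = cong (λ Z → lookup Z i) τX≡X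

  toggle-differAt-≡ : ∀ e X → differAt e X (toggle 𝓛 e X) ≡ 𝓛 (X △ e)
  toggle-differAt-≡ e X with toggle-cases e X
  ... | inj₁ (X△e∈𝓛 , τX≡X△e) = begin
    lookup X e xor lookup (toggle 𝓛 e X) e   ≡⟨ cong (λ Z → lookup X e xor lookup Z e) τX≡X△e ⟩
    lookup X e xor lookup (X △ e) e           ≡⟨ cong (lookup X e xor_) (lookup-△-≡ X e) ⟩
    lookup X e xor not (lookup X e)           ≡⟨ Boolₚ.xor-inverseʳ (lookup X e) ⟩
    true                                      ≡⟨ X△e∈𝓛 ⟨
    𝓛 (X △ e)                                 ∎
    where open ≡-Reasoning
  ... | inj₂ (X△e∉𝓛 , τX≡X) =
    trans (cong (λ Z → lookup X e xor lookup Z e) τX≡X) (trans (Boolₚ.xor-same (lookup X e)) (sym X△e∉𝓛))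

  toggle-differAt-≢ : ∀ {e i} X → e ≢ i → differAt i X (toggle 𝓛 e X) ≡ false
  toggle-differAt-≢ {e} {i} X e≢i =
    trans (cong (lookup X i xor_) (lookup-toggle-≢ X e≢i)) (Boolₚ.xor-same (lookup X i))

  act-∈ : ∀ w {X} → X ∈𝓛 𝓛 → act 𝓛 w X ∈𝓛 𝓛
  act-∈ []      X∈𝓛 = X∈𝓛
  act-∈ (e ∷ w) X∈𝓛 = toggle-∈ e (act-∈ w X∈𝓛)

  act-++ : ∀ v w X → act 𝓛 (v ++ w) X ≡ act 𝓛 v (act 𝓛 w X)
  act-++ v w X = Listₚ.foldr-++ (toggle 𝓛) X v w

  act-reverse : ∀ w {X} → X ∈𝓛 𝓛 → act 𝓛 (List.reverse w) (act 𝓛 w X) ≡ X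
  act-reverse []      X∈𝓛 = refl
  act-reverse (e ∷ w) {X} X∈𝓛 = begin
    act 𝓛 (List.reverse (e ∷ w)) (act 𝓛 (e ∷ w) X)
      ≡⟨ cong (λ v → act 𝓛 v (act 𝓛 (e ∷ w) X)) (Listₚ.unfold-reverse e w) ⟩
    act 𝓛 (List.reverse w List.∷ʳ e) (act 𝓛 (e ∷ w) X)
      ≡⟨ act-++ (List.reverse w) (e ∷ []) _ ⟩
    act 𝓛 (List.reverse w) (toggle 𝓛 e (toggle 𝓛 e (act 𝓛 w X)))
      ≡⟨ cong (act 𝓛 (List.reverse w)) (toggle-involutive e (act-∈ w X∈𝓛)) ⟩
    act 𝓛 (List.reverse w) (act 𝓛 w X)
      ≡⟨ act-reverse w X∈𝓛 ⟩
    X ∎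
    where open ≡-Reasoning

  act-injective : ∀ w {X Y} → X ∈𝓛 𝓛 → Y ∈𝓛 𝓛 → act 𝓛 w X ≡ act 𝓛 w Y → X ≡ Y
  act-injective w {X} {Y} X∈𝓛 Y∈𝓛 wX≡wY = begin
    X                                        ≡⟨ act-reverse w X∈𝓛 ⟨
    act 𝓛 (List.reverse w) (act 𝓛 w X)      ≡⟨ cong (act 𝓛 (List.reverse w)) wX≡wY ⟩
    act 𝓛 (List.reverse w) (act 𝓛 w Y)      ≡⟨ act-reverse w Y∈𝓛 ⟩
    Y                                        ∎
    where open ≡-Reasoning

-- The system of blocks generated by a block

module BlockSystem {n : ℕ} (𝓛 : Family n) (transitive : Transitive 𝓛)
                   (𝓑 : Family n) (block : IsBlock 𝓛 𝓑) {B₀ : Subset n} (B₀∈𝓑 : B₀ ∈𝓛 𝓑) where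

  open ToggleAction 𝓛

  𝓑⊆𝓛 : ∀ {X} → X ∈𝓛 𝓑 → X ∈𝓛 𝓛
  𝓑⊆𝓛 = proj₁ block _

  B₀∈𝓛 : B₀ ∈𝓛 𝓛
  B₀∈𝓛 = 𝓑⊆𝓛 B₀∈𝓑

  act-stabilises : ∀ w {X Y} → X ∈𝓛 𝓑 → Y ∈𝓛 𝓑 → act 𝓛 w X ∈𝓛 𝓑 → act 𝓛 w Y ∈𝓛 𝓑
  act-stabilises w {X} {Y} X∈𝓑 Y∈𝓑 wX∈𝓑 with proj₂ block w
  ... | inj₁ w𝓑≡𝓑   = proj₁ (w𝓑≡𝓑 (act 𝓛 w Y)) (Y , Y∈𝓑 , refl)
  ... | inj₂ w𝓑∩𝓑≡∅ = contradiction wX∈𝓑 (w𝓑∩𝓑≡∅ X X∈𝓑)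

  infix 4 _∼_
  _∼_ : Subset n → Subset n → Set
  X ∼ Y = ∃ λ w → act 𝓛 w X ∈𝓛 𝓑 × act 𝓛 w Y ∈𝓛 𝓑

  ∼-refl : ∀ {X} → X ∈𝓛 𝓛 → X ∼ X
  ∼-refl X∈𝓛 with w , wX≡B₀ ← transitive _ _ X∈𝓛 B₀∈𝓛 =
    w , subst (_∈𝓛 𝓑) (sym wX≡B₀) B₀∈𝓑 , subst (_∈𝓛 𝓑) (sym wX≡B₀) B₀∈𝓑

  ∼-sym : ∀ {X Y} → X ∼ Y → Y ∼ X
  ∼-sym (w , wX∈𝓑 , wY∈𝓑) = w , wY∈𝓑 , wX∈𝓑

  ∼-trans : ∀ {X Y Z} → Y ∈𝓛 𝓛 → Z ∈𝓛 𝓛 → X ∼ Y → Y ∼ Z → X ∼ Z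
  ∼-trans {X} {Y} {Z} Y∈𝓛 Z∈𝓛 (w , wX∈𝓑 , wY∈𝓑) (v , vY∈𝓑 , vZ∈𝓑) =
    w , wX∈𝓑 , subst (_∈𝓛 𝓑) (undo-v Z∈𝓛)
                 (act-stabilises (w ++ List.reverse v) vY∈𝓑 vZ∈𝓑 (subst (_∈𝓛 𝓑) (sym (undo-v Y∈𝓛)) wY∈𝓑))
    where
    undo-v : ∀ {U} → U ∈𝓛 𝓛 → act 𝓛 (w ++ List.reverse v) (act 𝓛 v U) ≡ act 𝓛 w U
    undo-v {U} U∈𝓛 = trans (act-++ w (List.reverse v) _) (cong (act 𝓛 w) (act-reverse v U∈𝓛))

  ∼-toggle : ∀ e {X Y} → X ∈𝓛 𝓛 → Y ∈𝓛 𝓛 → X ∼ Y → toggle 𝓛 e X ∼ toggle 𝓛 e Y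
  ∼-toggle e {X} {Y} X∈𝓛 Y∈𝓛 (w , wX∈𝓑 , wY∈𝓑) = w ++ (e ∷ []) , undo-e X∈𝓛 wX∈𝓑 , undo-e Y∈𝓛 wY∈𝓑
    where
    undo-e : ∀ {U} → U ∈𝓛 𝓛 → act 𝓛 w U ∈𝓛 𝓑 → act 𝓛 (w ++ (e ∷ [])) (toggle 𝓛 e U) ∈𝓛 𝓑
    undo-e {U} U∈𝓛 = subst (_∈𝓛 𝓑) (sym (trans (act-++ w (e ∷ []) _) (cong (act 𝓛 w) (toggle-involutive e U∈𝓛))))

  ∼-act : ∀ w {X Y} → X ∈𝓛 𝓛 → Y ∈𝓛 𝓛 → X ∼ Y → act 𝓛 w X ∼ act 𝓛 w Y
  ∼-act []      X∈𝓛 Y∈𝓛 X∼Y = X∼Y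
  ∼-act (e ∷ w) X∈𝓛 Y∈𝓛 X∼Y = ∼-toggle e (act-∈ w X∈𝓛) (act-∈ w Y∈𝓛) (∼-act w X∈𝓛 Y∈𝓛 X∼Y)

  ∈𝓑⇒∼ : ∀ {X Y} → X ∈𝓛 𝓑 → Y ∈𝓛 𝓑 → X ∼ Y
  ∈𝓑⇒∼ X∈𝓑 Y∈𝓑 = [] , X∈𝓑 , Y∈𝓑

  ∼-closed : ∀ {X Y} → X ∈𝓛 𝓑 → Y ∈𝓛 𝓛 → Y ∼ X → Y ∈𝓛 𝓑
  ∼-closed {X} {Y} X∈𝓑 Y∈𝓛 (w , wY∈𝓑 , wX∈𝓑) =
    subst (_∈𝓛 𝓑) (act-reverse w Y∈𝓛)
      (act-stabilises (List.reverse w) wX∈𝓑 wY∈𝓑 (subst (_∈𝓛 𝓑) (sym (act-reverse w (𝓑⊆𝓛 X∈𝓑))) X∈𝓑))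

  _∼?_ : ∀ {X Y} → X ∈𝓛 𝓛 → Y ∈𝓛 𝓛 → Dec (X ∼ Y)
  _∼?_ {X} {Y} X∈𝓛 Y∈𝓛 with w , wX≡B₀ ← transitive _ _ X∈𝓛 B₀∈𝓛 | 𝓑 (act 𝓛 w Y) in wY∈?𝓑
  ... | true  = yes (w , subst (_∈𝓛 𝓑) (sym wX≡B₀) B₀∈𝓑 , wY∈?𝓑)
  ... | false = no λ X∼Y → contradiction (trans (sym (wY∈𝓑 X∼Y)) wY∈?𝓑) λ ()
    where
    wY∈𝓑 : X ∼ Y → act 𝓛 w Y ∈𝓛 𝓑
    wY∈𝓑 X∼Y = ∼-closed B₀∈𝓑 (act-∈ w Y∈𝓛) (subst (act 𝓛 w Y ∼_) wX≡B₀ (∼-sym (∼-act w X∈𝓛 Y∈𝓛 X∼Y)))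

  toggle-leaving-block : ∀ f {Z Y} → Z ∈𝓛 𝓛 → Y ∈𝓛 𝓛 → Z ∼ Y → ¬ (Y ∼ toggle 𝓛 f Y) → Z △ f ∈𝓛 𝓛
  toggle-leaving-block f {Z} {Y} Z∈𝓛 Y∈𝓛 Z∼Y Y≁τY with toggle-cases f Z
  ... | inj₁ (Z△f∈𝓛 , _) = Z△f∈𝓛
  ... | inj₂ (_ , τZ≡Z)  =
    contradiction (∼-trans Z∈𝓛 (toggle-∈ f Y∈𝓛) (∼-sym Z∼Y)
                    (subst (_∼ toggle 𝓛 f Y) τZ≡Z (∼-toggle f Z∈𝓛 Y∈𝓛 Z∼Y)))
                  Y≁τY

  HasInternalEdge : Fin n → Subset n → Set
  HasInternalEdge e Y = ∃ λ Z → Z ∈𝓛 𝓛 × Z △ e ∈𝓛 𝓛 × Z ∼ Y × Z ∼ Z △ e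

  hasInternalEdge-toggle : ∀ e f {Y} → Y ∈𝓛 𝓛 → HasInternalEdge e Y → HasInternalEdge e (toggle 𝓛 f Y)
  hasInternalEdge-toggle e f {Y} Y∈𝓛 (Z , Z∈𝓛 , Z△e∈𝓛 , Z∼Y , Z∼Z△e) with Y∈𝓛 ∼? toggle-∈ f Y∈𝓛
  ... | yes Y∼τY = Z , Z∈𝓛 , Z△e∈𝓛 , ∼-trans Y∈𝓛 (toggle-∈ f Y∈𝓛) Z∼Y Y∼τY , Z∼Z△e
  ... | no Y≁τY  = Z △ f , Z△f∈𝓛 , subst (_∈𝓛 𝓛) (△-comm Z e f) Z△e△f∈𝓛 ,
                   subst (_∼ toggle 𝓛 f Y) (toggle-△ f Z△f∈𝓛) (∼-toggle f Z∈𝓛 Y∈𝓛 Z∼Y) ,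
                   subst₂ _∼_ (toggle-△ f Z△f∈𝓛) (trans (toggle-△ f Z△e△f∈𝓛) (△-comm Z e f))
                          (∼-toggle f Z∈𝓛 Z△e∈𝓛 Z∼Z△e)
    where
    Z△f∈𝓛 : Z △ f ∈𝓛 𝓛
    Z△f∈𝓛 = toggle-leaving-block f Z∈𝓛 Y∈𝓛 Z∼Y Y≁τY
    Z△e△f∈𝓛 : Z △ e △ f ∈𝓛 𝓛
    Z△e△f∈𝓛 = toggle-leaving-block f Z△e∈𝓛 Y∈𝓛 (∼-trans Z∈𝓛 Y∈𝓛 (∼-sym Z∼Z△e) Z∼Y) Y≁τY

  hasInternalEdge-act : ∀ e w {Y} → Y ∈𝓛 𝓛 → HasInternalEdge e Y → HasInternalEdge e (act 𝓛 w Y)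
  hasInternalEdge-act e []      Y∈𝓛 edge = edge
  hasInternalEdge-act e (f ∷ w) Y∈𝓛 edge =
    hasInternalEdge-toggle e f (act-∈ w Y∈𝓛) (hasInternalEdge-act e w Y∈𝓛 edge)

  hasInternalEdge⇒∼ : ∀ e {Y} → Y ∈𝓛 𝓛 → Y △ e ∈𝓛 𝓛 → HasInternalEdge e Y → Y ∼ Y △ e
  hasInternalEdge⇒∼ e {Y} Y∈𝓛 Y△e∈𝓛 (Z , Z∈𝓛 , Z△e∈𝓛 , Z∼Y , Z∼Z△e) =
    ∼-trans Z∈𝓛 Y△e∈𝓛 (∼-sym Z∼Y) (∼-trans Z△e∈𝓛 Y△e∈𝓛 Z∼Z△e
      (subst₂ _∼_ (toggle-△ e Z△e∈𝓛) (toggle-△ e Y△e∈𝓛) (∼-toggle e Z∈𝓛 Y∈𝓛 Z∼Y)))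

  internal-edges-propagate : ∀ e {Z Y} → Z ∈𝓛 𝓛 → Z △ e ∈𝓛 𝓛 → Z ∼ Z △ e →
                             Y ∈𝓛 𝓛 → Y △ e ∈𝓛 𝓛 → Y ∼ Y △ e
  internal-edges-propagate e {Z} {Y} Z∈𝓛 Z△e∈𝓛 Z∼Z△e Y∈𝓛 Y△e∈𝓛
    with w , wZ≡Y ← transitive Z Y Z∈𝓛 Y∈𝓛 =
    hasInternalEdge⇒∼ e Y∈𝓛 Y△e∈𝓛
      (subst (HasInternalEdge e) wZ≡Y (hasInternalEdge-act e w Z∈𝓛 (Z , Z∈𝓛 , Z△e∈𝓛 , ∼-refl Z∈𝓛 , Z∼Z△e)))

  module Classification (nontrivial : ∀ e → NontrivialToggle 𝓛 e) where

    edge : Fin n → Subset n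
    edge e = proj₁ (nontrivial e)

    edge-∈ : ∀ e → edge e ∈𝓛 𝓛
    edge-∈ e = proj₁ (proj₂ (nontrivial e))

    edge-△-∈ : ∀ e → edge e △ e ∈𝓛 𝓛
    edge-△-∈ e with toggle-cases e (edge e)
    ... | inj₁ (X△e∈𝓛 , _) = X△e∈𝓛
    ... | inj₂ (_ , τX≡X)  = contradiction τX≡X (proj₂ (proj₂ (nontrivial e)))

    internal? : Fin n → Bool
    internal? e = does (edge-∈ e ∼? edge-△-∈ e)

    internal⇒toggle-∼ : ∀ {e Y} → internal? e ≡ true → Y ∈𝓛 𝓛 → toggle 𝓛 e Y ∼ Y
    internal⇒toggle-∼ {e} {Y} internal Y∈𝓛 with edge-∈ e ∼? edge-△-∈ e | toggle-cases e Y
    ... | no _          | _                  = contradiction internal λ ()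
    ... | yes edge∼edge | inj₁ (Y△e∈𝓛 , τY≡Y△e) =
      subst (_∼ Y) (sym τY≡Y△e) (∼-sym (internal-edges-propagate e (edge-∈ e) (edge-△-∈ e) edge∼edge Y∈𝓛 Y△e∈𝓛))
    ... | yes _         | inj₂ (_ , τY≡Y)   = subst (_∼ Y) (sym τY≡Y) (∼-refl Y∈𝓛)

    external⇒≁ : ∀ {e Y} → internal? e ≡ false → Y ∈𝓛 𝓛 → Y △ e ∈𝓛 𝓛 → ¬ (Y ∼ Y △ e)
    external⇒≁ {e} external Y∈𝓛 Y△e∈𝓛 Y∼Y△e with edge-∈ e ∼? edge-△-∈ e
    ... | yes _         = contradiction external λ ()
    ... | no edge≁edge = edge≁edge (internal-edges-propagate e Y∈𝓛 Y△e∈𝓛 Y∼Y△e (edge-∈ e) (edge-△-∈ e))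

    external-toggle-uniform : ∀ {f X Z} → internal? f ≡ false → X ∈𝓛 𝓛 → Z ∈𝓛 𝓛 → X ∼ Z →
                              𝓛 (X △ f) ≡ 𝓛 (Z △ f)
    external-toggle-uniform {f} {X} {Z} external X∈𝓛 Z∈𝓛 X∼Z with toggle-cases f X | toggle-cases f Z
    ... | inj₁ (X△f∈𝓛 , _)       | inj₁ (Z△f∈𝓛 , _)      = trans X△f∈𝓛 (sym Z△f∈𝓛)
    ... | inj₂ (X△f∉𝓛 , _)       | inj₂ (Z△f∉𝓛 , _)      = trans X△f∉𝓛 (sym Z△f∉𝓛)
    ... | inj₁ (X△f∈𝓛 , τX≡X△f) | inj₂ (_ , τZ≡Z)        =
      contradiction (∼-sym (∼-trans Z∈𝓛 X∈𝓛 (subst₂ _∼_ τX≡X△f τZ≡Z (∼-toggle f X∈𝓛 Z∈𝓛 X∼Z)) (∼-sym X∼Z)))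
                    (external⇒≁ external X∈𝓛 X△f∈𝓛)
    ... | inj₂ (_ , τX≡X)        | inj₁ (Z△f∈𝓛 , τZ≡Z△f) =
      contradiction (∼-sym (∼-trans X∈𝓛 Z∈𝓛 (subst₂ _∼_ τZ≡Z△f τX≡X (∼-toggle f Z∈𝓛 X∈𝓛 (∼-sym X∼Z))) X∼Z))
                    (external⇒≁ external Z∈𝓛 Z△f∈𝓛)

    external-differAt-toggle : ∀ {f} g {X Z} → internal? f ≡ false → X ∈𝓛 𝓛 → Z ∈𝓛 𝓛 → X ∼ Z →
                               differAt f X (toggle 𝓛 g X) ≡ differAt f Z (toggle 𝓛 g Z)
    external-differAt-toggle {f} g {X} {Z} external X∈𝓛 Z∈𝓛 X∼Z with g Finₚ.≟ f
    ... | yes refl = trans (toggle-differAt-≡ g X)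
                       (trans (external-toggle-uniform external X∈𝓛 Z∈𝓛 X∼Z) (sym (toggle-differAt-≡ g Z)))
    ... | no g≢f   = trans (toggle-differAt-≢ X g≢f) (sym (toggle-differAt-≢ Z g≢f))

    external-differAt-act : ∀ {f} w {X Z} → internal? f ≡ false → X ∈𝓛 𝓛 → Z ∈𝓛 𝓛 → X ∼ Z →
                            differAt f X (act 𝓛 w X) ≡ differAt f Z (act 𝓛 w Z)
    external-differAt-act {f} []      {X} {Z} _ _ _ _ =
      trans (Boolₚ.xor-same (lookup X f)) (sym (Boolₚ.xor-same (lookup Z f)))
    external-differAt-act {f} (g ∷ w) {X} {Z} external X∈𝓛 Z∈𝓛 X∼Z = begin
      differAt f X (act 𝓛 (g ∷ w) X)
        ≡⟨ differAt-trans f X (act 𝓛 w X) (act 𝓛 (g ∷ w) X) ⟩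
      differAt f X (act 𝓛 w X) xor differAt f (act 𝓛 w X) (act 𝓛 (g ∷ w) X)
        ≡⟨ cong₂ _xor_ (external-differAt-act w external X∈𝓛 Z∈𝓛 X∼Z)
                        (external-differAt-toggle g external (act-∈ w X∈𝓛) (act-∈ w Z∈𝓛) (∼-act w X∈𝓛 Z∈𝓛 X∼Z)) ⟩
      differAt f Z (act 𝓛 w Z) xor differAt f (act 𝓛 w Z) (act 𝓛 (g ∷ w) Z)
        ≡⟨ differAt-trans f Z (act 𝓛 w Z) (act 𝓛 (g ∷ w) Z) ⟨
      differAt f Z (act 𝓛 (g ∷ w) Z)
        ∎
      where open ≡-Reasoning

    external-constant-on-𝓑 : ∀ {f X Y} → Odd (card 𝓑) → internal? f ≡ false → X ∈𝓛 𝓑 → Y ∈𝓛 𝓑 →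
                             lookup X f ≡ lookup Y f
    external-constant-on-𝓑 {f} {X} {Y} odd external X∈𝓑 Y∈𝓑 with lookup X f Boolₚ.≟ lookup Y f
    ... | yes Xf≡Yf = Xf≡Yf
    ... | no Xf≢Yf with w , wX≡Y ← transitive X Y (𝓑⊆𝓛 X∈𝓑) (𝓑⊆𝓛 Y∈𝓑) =
      contradiction odd (flipping-injection⇒¬odd-card 𝓑 (λ Z → lookup Z f) (act 𝓛 w)
        (λ Z∈𝓑 → act-stabilises w X∈𝓑 Z∈𝓑 (subst (_∈𝓛 𝓑) (sym wX≡Y) Y∈𝓑))
        flips
        (λ Z∈𝓑 Z′∈𝓑 → act-injective w (𝓑⊆𝓛 Z∈𝓑) (𝓑⊆𝓛 Z′∈𝓑)))
      where
      flips : ∀ {Z} → Z ∈𝓛 𝓑 → lookup (act 𝓛 w Z) f ≡ not (lookup Z f)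
      flips {Z} Z∈𝓑 = xor≡true⇒≡not (begin
        differAt f Z (act 𝓛 w Z) ≡⟨ external-differAt-act w external (𝓑⊆𝓛 Z∈𝓑) (𝓑⊆𝓛 X∈𝓑) (∈𝓑⇒∼ Z∈𝓑 X∈𝓑) ⟩
        differAt f X (act 𝓛 w X) ≡⟨ cong (differAt f X) wX≡Y ⟩
        differAt f X Y           ≡⟨ cong (_xor lookup Y f) (Boolₚ.¬-not Xf≢Yf) ⟩
        not (lookup Y f) xor lookup Y f ≡⟨ Boolₚ.xor-inverseˡ (lookup Y f) ⟩
        true                     ∎)
        where open ≡-Reasoning

    external-constant-on-blocks : ∀ {f X Y} → Odd (card 𝓑) → internal? f ≡ false →
                                  X ∈𝓛 𝓛 → Y ∈𝓛 𝓛 → X ∼ Y → lookup X f ≡ lookup Y f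
    external-constant-on-blocks {f} {X} {Y} odd external X∈𝓛 Y∈𝓛 X∼Y@(w , wX∈𝓑 , wY∈𝓑) =
      xor-cancelʳ (begin
        lookup X f xor lookup (act 𝓛 w X) f  ≡⟨ external-differAt-act w external X∈𝓛 Y∈𝓛 X∼Y ⟩
        lookup Y f xor lookup (act 𝓛 w Y) f  ≡⟨ cong (lookup Y f xor_) (external-constant-on-𝓑 odd external wY∈𝓑 wX∈𝓑) ⟩
        lookup Y f xor lookup (act 𝓛 w X) f  ∎)
      where
      open ≡-Reasoning
      xor-cancelʳ : ∀ {x y a} → x xor a ≡ y xor a → x ≡ y
      xor-cancelʳ {false} {false} _ = refl
      xor-cancelʳ {true}  {true}  _ = refl
      xor-cancelʳ {false} {true}  a≡¬a = contradiction a≡¬a (Boolₚ.not-¬ refl)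
      xor-cancelʳ {true}  {false} ¬a≡a = contradiction (sym ¬a≡a) (Boolₚ.not-¬ refl)

    internalSet : Subset n
    internalSet = tabulate internal?

    lookup-internalSet : ∀ i → lookup internalSet i ≡ internal? i
    lookup-internalSet = Vecₚ.lookup∘tabulate internal?

    externalLetters : List (Fin n) → List (Fin n)
    externalLetters []      = []
    externalLetters (g ∷ w) = if internal? g then externalLetters w else g ∷ externalLetters w

    externalLetters-∼ : ∀ w {Y} → Y ∈𝓛 𝓛 → act 𝓛 (externalLetters w) Y ∼ act 𝓛 w Y
    externalLetters-∼ []      Y∈𝓛 = ∼-refl Y∈𝓛
    externalLetters-∼ (g ∷ w) {Y} Y∈𝓛 with internal? g in internal
    ... | true  = ∼-trans wY∈𝓛 (toggle-∈ g wY∈𝓛) (externalLetters-∼ w Y∈𝓛) (∼-sym (internal⇒toggle-∼ internal wY∈𝓛))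
      where
      wY∈𝓛 : act 𝓛 w Y ∈𝓛 𝓛
      wY∈𝓛 = act-∈ w Y∈𝓛
    ... | false = ∼-toggle g (act-∈ (externalLetters w) Y∈𝓛) (act-∈ w Y∈𝓛) (externalLetters-∼ w Y∈𝓛)

    externalLetters-fix-internal : ∀ w Y {i} → internal? i ≡ true →
                                   lookup (act 𝓛 (externalLetters w) Y) i ≡ lookup Y i
    externalLetters-fix-internal []      Y _ = refl
    externalLetters-fix-internal (g ∷ w) Y {i} internal-i with internal? g in internal-g
    ... | true  = externalLetters-fix-internal w Y internal-i
    ... | false = trans (lookup-toggle-≢ (act 𝓛 (externalLetters w) Y) g≢i)
                        (externalLetters-fix-internal w Y internal-i)
      where
      g≢i : g ≢ i
      g≢i refl = contradiction (trans (sym internal-g) internal-i) λ ()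

    splice-closed : Odd (card 𝓑) → ∀ {X Y} → X ∈𝓛 𝓛 → Y ∈𝓛 𝓛 → splice internalSet X Y ∈𝓛 𝓛
    splice-closed odd {X} {Y} X∈𝓛 Y∈𝓛 with w , wY≡X ← transitive Y X Y∈𝓛 X∈𝓛 =
      subst (_∈𝓛 𝓛) (sym (splice-unique coordinates)) (act-∈ (externalLetters w) Y∈𝓛)
      where
      U : Subset n
      U = act 𝓛 (externalLetters w) Y
      U∼X : U ∼ X
      U∼X = subst (U ∼_) wY≡X (externalLetters-∼ w Y∈𝓛)
      coordinates : ∀ i → lookup U i ≡ (if lookup internalSet i then lookup Y i else lookup X i)
      coordinates i rewrite lookup-internalSet i with internal? i in internal-i
      ... | true  = externalLetters-fix-internal w Y internal-i
      ... | false = external-constant-on-blocks odd internal-i (act-∈ (externalLetters w) Y∈𝓛) X∈𝓛 U∼X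

    all-internal⇒𝓛⊆𝓑 : (∀ e → internal? e ≡ true) → ∀ {Y} → Y ∈𝓛 𝓛 → Y ∈𝓛 𝓑
    all-internal⇒𝓛⊆𝓑 all-internal {Y} Y∈𝓛 with w , wB₀≡Y ← transitive B₀ Y B₀∈𝓛 Y∈𝓛 =
      ∼-closed B₀∈𝓑 Y∈𝓛 (subst (_∼ B₀) wB₀≡Y (stays w))
      where
      stays : ∀ w → act 𝓛 w B₀ ∼ B₀
      stays []      = ∼-refl B₀∈𝓛
      stays (g ∷ w) = ∼-trans (act-∈ w B₀∈𝓛) B₀∈𝓛 (internal⇒toggle-∼ (all-internal g) (act-∈ w B₀∈𝓛)) (stays w)

    external-exists : card 𝓑 < card 𝓛 → ∃ λ f → internal? f ≡ false
    external-exists 𝓑<𝓛 with Finₚ.any? (λ f → internal? f Boolₚ.≟ false)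
    ... | yes external = external
    ... | no ¬external = contradiction (⊆⇒card-≤ {𝓐 = 𝓛} {𝓑} (all-internal⇒𝓛⊆𝓑 all-internal)) (ℕₚ.<⇒≱ 𝓑<𝓛)
      where
      all-internal : ∀ e → internal? e ≡ true
      all-internal e = Boolₚ.¬-not (λ internal≡false → ¬external (e , internal≡false))

lemma2p7 : (n : ℕ) (𝓛 : Family n) →
           (∀ (e : Fin n) → NontrivialToggle 𝓛 e) →
           Transitive 𝓛 →
           (𝓑 : Family n) → IsImprimitivityBlock 𝓛 𝓑 → Odd (card 𝓑) →
           ∃ λ (E₁ : Subset n) → ∃ λ (E₂ : Subset n) → ∃ λ (𝓛₁ : Family n) → ∃ λ (𝓛₂ : Family n) →
             Disjoint E₁ E₂ × FamilyOver 𝓛₁ E₁ × FamilyOver 𝓛₂ E₂ ×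
             2 ≤ card 𝓛₁ × 2 ≤ card 𝓛₂ × IsProduct 𝓛 𝓛₁ 𝓛₂
lemma2p7 n 𝓛 nontrivial transitive 𝓑 (block , 1<|𝓑| , |𝓑|<|𝓛|) odd
  with B₀ , B₁ , B₀∈𝓑 , B₁∈𝓑 , B₀≢B₁ ← 2≤card⇒distinct {𝓐 = 𝓑} 1<|𝓑| =
  ∁ internalSet , internalSet , outerFactor , innerFactor ,
  (λ _ → x∈∁p⇒x∉p) , outerFactor-over , innerFactor-over , 2≤|outerFactor| , 2≤|innerFactor| , isProduct
  where
  open BlockSystem 𝓛 transitive 𝓑 block B₀∈𝓑
  open Classification nontrivial
  open SpliceClosed 𝓛 internalSet (splice-closed odd) B₀ B₀∈𝓛

  2≤|innerFactor| : 2 ≤ card innerFactor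
  2≤|innerFactor| = 2≤card-innerFactor B₀∈𝓛 (𝓑⊆𝓛 B₁∈𝓑) B₀≢B₁ λ i i∉E →
    external-constant-on-𝓑 odd (trans (sym (lookup-internalSet i)) i∉E) B₀∈𝓑 B₁∈𝓑

  2≤|outerFactor| : 2 ≤ card outerFactor
  2≤|outerFactor| with f , external ← external-exists |𝓑|<|𝓛| =
    2≤card-outerFactor (edge-∈ f) (edge-△-∈ f) edge≢edge△f λ i i∈E → sym (lookup-△-≢ (edge f) (f≢internal i i∈E))
    where
    f≢internal : ∀ i → lookup internalSet i ≡ true → f ≢ i
    f≢internal i i∈E refl = contradiction (trans (sym external) (trans (sym (lookup-internalSet i)) i∈E)) λ ()
    edge≢edge△f : edge f ≢ edge f △ f
    edge≢edge△f eq = Boolₚ.not-¬ refl (trans (cong (λ Z → lookup Z f) eq) (lookup-△-≡ (edge f) f))
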